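{- Let $\Sigma \subseteq \mathcal{L}_{\mathsf{Ldm}}$ be $\mathsf{Ldm}$-consistent. Then $\Sigma$ is satisfiable: there exist a $\mathsf{Tstit}$-model $M$ and a world $w$ of $M$ such that $M, w \models \phi$ for every $\phi \in \Sigma$.
   Context: Fix a finite set of agents $Ag=\{1,\dots,n\}$ and a countable set $Var$ of propositional variables. Formulas are in negation normal form. $\mathcal{L}_{\mathsf{Ldm}}$: $\phi ::= p \mid \overline{p} \mid \phi\wedge\phi \mid \phi\vee\phi \mid \Box\phi \mid \Diamond\phi \mid [i]\phi \mid \langle i\rangle\phi$ with $p\in Var$, $i \in Ag$. The negation $\overline{\phi}$ of a formula is obtained by swapping every operator with its dual ($\wedge/\vee$, $\Box/\Diamond$, $[i]/\langle i\rangle$) and every $p$ with $\overline{p}$. Abbreviations: $\phi\to\psi := \overline{\phi}\vee\psi$, $\phi\leftrightarrow\psi := (\phi\to\psi)\wedge(\psi\to\phi)$, $\top := p\vee\overline p$, $\bot := p\wedge\overline p$. The Hilbert system $\mathsf{Ldm}$ has axioms (all instances): $\phi\to(\psi\to\phi)$; $(\overline\psi\to\overline\phi)\to(\phi\to\psi)$; $(\phi\to(\psi\to\chi))\to((\phi\to\psi)\to(\phi\to\chi))$; $\Box\phi\to\phi$; $\Diamond\phi\to\Box\Diamond\phi$; $\Box(\phi\to\psi)\to(\Box\phi\to\Box\psi)$; $[i]\phi\to\phi$; $\langle i\rangle\phi\to[i]\langle i\rangle\phi$; $\Box\phi\vee\Diamond\overline\phi$; $[i]\phi\vee\langle i\rangle\overline\phi$;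 $\bigwedge_{i\in Ag}\Diamond[i]\phi_i \to \Diamond(\bigwedge_{i\in Ag}[i]\phi_i)$; $[i](\phi\to\psi)\to([i]\phi\to[i]\psi)$; $\Box\phi\to[i]\phi$; and rules: from $\phi$ infer $\Box\phi$; from $\phi$ and $\phi\to\psi$ infer $\psi$. $\vdash_{\mathsf{Ldm}}\phi$ means $\phi$ is a theorem. A set $\Sigma$ is $\mathsf{Ldm}$-consistent iff $\Sigma\not\vdash_{\mathsf{Ldm}}\bot$, i.e. there is no finite $\{\sigma_1,\dots,\sigma_k\}\subseteq\Sigma$ with $\vdash_{\mathsf{Ldm}} (\sigma_1\wedge\dots\wedge\sigma_k)\to\bot$. A $\mathsf{Tstit}$-frame is a tuple $(W,\mathcal{R}_\Box,\{\mathcal{R}_i\}_{i\in Ag},\mathcal{R}_{Ag},\mathcal{R}_{\mathsf G},\mathcal{R}_{\mathsf H})$ with $W\neq\emptyset$, where $\mathcal{R}_\Box$, each $\mathcal{R}_i$, and $\mathcal{R}_{Ag}$ are equivalence relations on $W$ (write $\mathcal{R}(w)=\{v : (w,v)\in\mathcal{R}\}$) such that: (C1) $\mathcal{R}_i\subseteq\mathcal{R}_\Box$ for each $i$; (C2) for all $u_1,\dots,u_n\in W$, if $\mathcal{R}_\Box u_iu_j$ for all $1\le i,j\le n$ then $\bigcap_i\mathcal{R}_i(u_i)\neq\emptyset$; (C3) $\mathcal{R}_{Ag}(w)=\bigcap_{i\in Ag}\mathcal{R}_i(w)$ for all $w$; $\mathcal{R}_{\mathsf G}$ is transitive and serial and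 $\mathcal{R}_{\mathsf H}$ is its converse; (C4) if $\mathcal{R}_{\mathsf G}wu$ and $\mathcal{R}_{\mathsf G}wv$ then $\mathcal{R}_{\mathsf G}uv$ or $u=v$ or $\mathcal{R}_{\mathsf G}vu$; (C5) the same for $\mathcal{R}_{\mathsf H}$; (C6) $\mathcal{R}_{\mathsf G}\circ\mathcal{R}_\Box\subseteq\mathcal{R}_{Ag}\circ\mathcal{R}_{\mathsf G}$; (C7) if $u\in\mathcal{R}_\Box(w)$ then $u\notin\mathcal{R}_{\mathsf G}(w)$. A $\mathsf{Tstit}$-model adds a valuation $V:Var\to\mathcal{P}(W)$. Satisfaction: $w\models p$ iff $w\in V(p)$; $w\models\overline p$ iff $w\notin V(p)$; $\wedge,\vee$ as usual; $w\models\Box\phi$ iff all $u\in\mathcal{R}_\Box(w)$ satisfy $\phi$; $w\models\Diamond\phi$ iff some $u\in\mathcal{R}_\Box(w)$ satisfies $\phi$; likewise $[i]$/$\langle i\rangle$ with $\mathcal{R}_i$. -}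

module Defs where

open import Level using (0ℓ)
open import Data.Nat using (ℕ; zero; suc)
open import Data.Fin using (Fin; zero; suc)
open import Data.List using (List; []; _∷_)
open import Data.List.Relation.Unary.All using (All)
open import Data.Product using (Σ; ∃; _×_; _,_)
open import Data.Sum using (_⊎_)
open import Relation.Nullary using (¬_)
open import Relation.Binary.PropositionalEquality using (_≡_)
open import Relation.Binary.Structures using (IsEquivalence)
open import Function using (_∘_)

Var : Set
Var = ℕ

-- Formulas of L_Ldm in negation normal form, for agents Ag = Fin n.
data Fm (n : ℕ) : Set where
  var  : Var → Fm n
  nvar : Var → Fm n
  _∧_  : Fm n → Fm n → Fm n
  _∨_  : Fm n → Fm n → Fm n
  □_   : Fm n → Fm n
  ◇_   : Fm n → Fm n
  [_]_ : Fin n → Fm n → Fm n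
  ⟨_⟩_ : Fin n → Fm n → Fm n

infixr 6 _∧_
infixr 5 _∨_
infixr 4 _⇒_

neg : ∀ {n} → Fm n → Fm n
neg (var p) = nvar p
neg (nvar p) = var p
neg (φ ∧ ψ) = neg φ ∨ neg ψ
neg (φ ∨ ψ) = neg φ ∧ neg ψ
neg (□ φ) = ◇ neg φ
neg (◇ φ) = □ neg φ
neg ([ i ] φ) = ⟨ i ⟩ neg φ
neg (⟨ i ⟩ φ) = [ i ] neg φ

_⇒_ : ∀ {n} → Fm n → Fm n → Fm n
φ ⇒ ψ = neg φ ∨ ψ

⊤f : ∀ {n} → Fm n
⊤f = var 0 ∨ nvar 0

⊥f : ∀ {n} → Fm n
⊥f = var 0 ∧ nvar 0

conj : ∀ {n} (k : ℕ) → (Fin k → Fm n) → Fm n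
conj zero f = ⊤f
conj (suc zero) f = f zero
conj (suc (suc k)) f = f zero ∧ conj (suc k) (f ∘ suc)

conjL : ∀ {n} → List (Fm n) → Fm n
conjL [] = ⊤f
conjL (φ ∷ []) = φ
conjL (φ ∷ ψ ∷ l) = φ ∧ conjL (ψ ∷ l)

data ⊢ {n : ℕ} : Fm n → Set where
  ax1  : ∀ φ ψ → ⊢ (φ ⇒ (ψ ⇒ φ))
  ax2  : ∀ φ ψ → ⊢ ((neg ψ ⇒ neg φ) ⇒ (φ ⇒ ψ))
  ax3  : ∀ φ ψ χ → ⊢ ((φ ⇒ (ψ ⇒ χ)) ⇒ ((φ ⇒ ψ) ⇒ (φ ⇒ χ)))
  T□   : ∀ φ → ⊢ (□ φ ⇒ φ)
  5□   : ∀ φ → ⊢ (◇ φ ⇒ □ ◇ φ)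
  K□   : ∀ φ ψ → ⊢ (□ (φ ⇒ ψ) ⇒ (□ φ ⇒ □ ψ))
  Ti   : ∀ i φ → ⊢ ([ i ] φ ⇒ φ)
  5i   : ∀ i φ → ⊢ (⟨ i ⟩ φ ⇒ [ i ] ⟨ i ⟩ φ)
  dual□ : ∀ φ → ⊢ (□ φ ∨ ◇ neg φ)
  duali : ∀ i φ → ⊢ ([ i ] φ ∨ ⟨ i ⟩ neg φ)
  IA   : ∀ (φs : Fin n → Fm n) →
           ⊢ (conj n (λ i → ◇ [ i ] φs i) ⇒ ◇ conj n (λ i → [ i ] φs i))
  Ki   : ∀ i φ ψ → ⊢ ([ i ] (φ ⇒ ψ) ⇒ ([ i ] φ ⇒ [ i ] ψ))
  □i   : ∀ i φ → ⊢ (□ φ ⇒ [ i ] φ)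
  nec  : ∀ {φ} → ⊢ φ → ⊢ (□ φ)
  mp   : ∀ {φ ψ} → ⊢ φ → ⊢ (φ ⇒ ψ) → ⊢ ψ

Consistent : ∀ {n} → (Fm n → Set) → Set
Consistent {n} Γ = ¬ (Σ (List (Fm n)) λ σs → All Γ σs × ⊢ (conjL σs ⇒ ⊥f))

Rel : Set → Set₁
Rel W = W → W → Set

record TstitFrame (n : ℕ) : Set₁ where
  field
    W   : Set
    w₀  : W                                  -- W ≠ ∅
    R□  : Rel W
    R   : Fin n → Rel W
    RAg : Rel W
    RG  : Rel W
    RH  : Rel W
    eq□  : IsEquivalence R□
    eqi  : ∀ i → IsEquivalence (R i)
    eqAg : IsEquivalence RAg
    C1 : ∀ i w v → R i w v → R□ w v
    C2 : ∀ (u : Fin n → W) → (∀ i j → R□ (u i) (u j)) →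
           ∃ λ v → ∀ i → R i (u i) v
    C3 : ∀ w v → (RAg w v → ∀ i → R i w v) × ((∀ i → R i w v) → RAg w v)
    G-trans  : ∀ u v w → RG u v → RG v w → RG u w
    G-serial : ∀ w → ∃ λ v → RG w v
    H-conv   : ∀ w v → (RH w v → RG v w) × (RG v w → RH w v)
    C4 : ∀ w u v → RG w u → RG w v → RG u v ⊎ u ≡ v ⊎ RG v u
    C5 : ∀ w u v → RH w u → RH w v → RH u v ⊎ u ≡ v ⊎ RH v u
    -- R_G ∘ R_□ ⊆ R_Ag ∘ R_G  (first R_G then R_□, resp. first R_Ag then R_G)
    C6 : ∀ w u v → RG w u → R□ u v → ∃ λ z → RAg w z × RG z v
    C7 : ∀ w u → R□ w u → ¬ RG w u

record TstitModel (n : ℕ) : Set₁ where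
  field
    frame : TstitFrame n
  open TstitFrame frame public
  field
    V : Var → W → Set

module _ {n : ℕ} (M : TstitModel n) where
  open TstitModel M
  _⊨_ : W → Fm n → Set
  w ⊨ var p = V p w
  w ⊨ nvar p = ¬ V p w
  w ⊨ (φ ∧ ψ) = (w ⊨ φ) × (w ⊨ ψ)
  w ⊨ (φ ∨ ψ) = (w ⊨ φ) ⊎ (w ⊨ ψ)
  w ⊨ (□ φ) = ∀ u → R□ w u → u ⊨ φ
  w ⊨ (◇ φ) = ∃ λ u → R□ w u × (u ⊨ φ)
  w ⊨ ([ i ] φ) = ∀ u → R i w u → u ⊨ φ
  w ⊨ (⟨ i ⟩ φ) = ∃ λ u → R i w u × (u ⊨ φ)

module Submission where

-- 1. Derivations from hypotheses satisfy the deduction theorem and the usual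
--    propositional rules; by compactness, an Ldm-consistent set does not
--    derive ⊥.
-- 2. Formulas are enumerated in finite stages, so excluded middle yields the
--    Lindenbaum lemma: every consistent set extends to a maximal consistent
--    set (MCS).
-- 3. □ and each [i] are S5 modalities; for such a modality the canonical
--    relation "same boxed formulas" is an equivalence relation satisfying the
--    canonical truth conditions. With the axioms □φ → [i]φ and (IA) this gives
--    an Ldm-frame on the MCSs (conditions C1 and C2).
-- 4. Every Ldm-frame extends to a Tstit-frame: take ℕ copies of it, keep the
--    frame on copy 0, make the later copies discrete, and let time run
--    through the copies.
-- 5. In the Tstit-model obtained from the canonical Ldm-frame, an MCS at
--    moment 0 satisfies exactly its members (truth lemma); this gives the
--    theorem.

open import Defs
open import Level using (0ℓ)
open import Axiom.ExcludedMiddle using (ExcludedMiddle)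
open import Data.Nat using (ℕ; _≤_)
open import Data.Product using (Σ)

open import Data.Nat using (zero; suc; _<_; _⊔_; _≤′_; ≤′-reflexive; ≤′-step)
open import Data.Nat.Properties using (<-trans; <-cmp; m≤m⊔n; m≤n⊔m; <-irrefl; n<1+n; ≤⇒≤′)
open import Data.Fin using (Fin; zero; suc) renaming (_≟_ to _≟ᶠ_)
open import Data.Vec.Functional using (updateAt)
open import Data.Vec.Functional.Properties using (updateAt-updates; updateAt-minimal)
open import Data.Bool using (Bool; true; false)
open import Data.List using (List; []; _∷_; _++_; map; concatMap; cartesianProductWith; allFin)
open import Data.List.Membership.Propositional using (_∈_; lose)
open import Data.List.Membership.Propositional.Properties
  using (∈-++⁺ˡ; ∈-++⁺ʳ; ∈-map⁺; ∈-concatMap⁺; ∈-cartesianProductWith⁺; ∈-allFin)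
open import Data.List.Relation.Unary.Any using (here; there)
open import Data.List.Relation.Unary.All using (All; []; _∷_; lookup)
import Data.List.Relation.Unary.All as All
open import Data.List.Relation.Unary.All.Properties using (++⁺)
open import Data.Product using (∃; ∃₂; _×_; _,_; proj₁; proj₂)
open import Data.Sum using (_⊎_; inj₁; inj₂; [_,_]′) renaming (map to ⊎-map)
open import Data.Empty using (⊥; ⊥-elim)
open import Function using (_∘_)
open import Function.Bundles using (_⇔_; mk⇔; Equivalence)
open import Function.Construct.Composition using (_⇔-∘_)
open import Function.Construct.Identity using (⇔-id)
open import Data.Product.Function.NonDependent.Propositional using (_×-⇔_)
open import Data.Sum.Function.Propositional using (_⊎-⇔_)
open import Relation.Nullary using (¬_; Dec; yes; no)
open import Relation.Binary.PropositionalEquality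
  using (_≡_; _≢_; refl; sym; trans; cong; cong₂; subst; subst₂)
open import Relation.Binary.Structures using (IsEquivalence)
open import Relation.Binary.Definitions using (tri<; tri≈; tri>)

open Equivalence using (to; from)

module Derivation {n : ℕ} where

  Theory : Set₁
  Theory = Fm n → Set

  -- Der Δ φ: φ follows from hypotheses in Δ, theorems of Ldm and modus ponens.
  -- Necessitation is only available for theorems, so the deduction theorem holds.
  data Der (Δ : Theory) : Fm n → Set where
    hyp : ∀ {φ} → Δ φ → Der Δ φ
    thm : ∀ {φ} → ⊢ φ → Der Δ φ
    mp  : ∀ {φ ψ} → Der Δ φ → Der Δ (φ ⇒ ψ) → Der Δ ψ

  _,,_ : Theory → Fm n → Theory
  (Δ ,, a) x = Δ x ⊎ x ≡ a

  ∅ : Theory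
  ∅ _ = ⊥

  private
    variable
      Δ Δ' : Theory
      a b : Fm n

  neg-involutive : (φ : Fm n) → neg (neg φ) ≡ φ
  neg-involutive (var p) = refl
  neg-involutive (nvar p) = refl
  neg-involutive (φ ∧ ψ) = cong₂ _∧_ (neg-involutive φ) (neg-involutive ψ)
  neg-involutive (φ ∨ ψ) = cong₂ _∨_ (neg-involutive φ) (neg-involutive ψ)
  neg-involutive (□ φ) = cong □_ (neg-involutive φ)
  neg-involutive (◇ φ) = cong ◇_ (neg-involutive φ)
  neg-involutive ([ i ] φ) = cong [ i ]_ (neg-involutive φ)
  neg-involutive (⟨ i ⟩ φ) = cong ⟨ i ⟩_ (neg-involutive φ)

  cut : (∀ {x} → Δ x → Der Δ' x) → Der Δ a → Der Δ' a
  cut f (hyp x) = f x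
  cut f (thm t) = thm t
  cut f (mp d e) = mp (cut f d) (cut f e)

  weaken : (∀ {x} → Δ x → Δ' x) → Der Δ a → Der Δ' a
  weaken f = cut (hyp ∘ f)

  der-∅⇒⊢ : Der ∅ a → ⊢ a
  der-∅⇒⊢ (hyp ())
  der-∅⇒⊢ (thm t) = t
  der-∅⇒⊢ (mp d e) = mp (der-∅⇒⊢ d) (der-∅⇒⊢ e)

  assumption : Der (Δ ,, a) a
  assumption = hyp (inj₂ refl)

  wk : Der Δ b → Der (Δ ,, a) b
  wk = weaken inj₁

  ⊢-refl : (a : Fm n) → ⊢ (a ⇒ a)
  ⊢-refl a = mp (ax1 a a) (mp (ax1 a (a ⇒ a)) (ax3 a (a ⇒ a) a))

  deduction : Der (Δ ,, a) b → Der Δ (a ⇒ b)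
  deduction {a = a} {b} (hyp (inj₁ x)) = mp (hyp x) (thm (ax1 b a))
  deduction {a = a} (hyp (inj₂ refl)) = thm (⊢-refl a)
  deduction {a = a} {b} (thm t) = mp (thm t) (thm (ax1 b a))
  deduction {a = a} (mp {φ} {ψ} d e) = mp (deduction d) (mp (deduction e) (thm (ax3 a φ ψ)))

  ex-falso : Der Δ a → Der Δ (neg a) → Der Δ b
  ex-falso {a = a} {b} d e = mp d (mp (mp e (thm (ax1 (neg a) (neg b)))) (thm (ax2 a b)))

  by-contradiction : Der (Δ ,, neg a) b → Der (Δ ,, neg a) (neg b) → Der Δ a
  by-contradiction {a = a} d e =
    mp (thm (⊢-refl a)) (mp (deduction (ex-falso {b = neg (a ⇒ a)} d e)) (thm (ax2 (a ⇒ a) a)))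

  ∧-intro : Der Δ a → Der Δ b → Der Δ (a ∧ b)
  ∧-intro d e = by-contradiction (wk e) (mp (wk d) assumption)

  ∧-elimˡ : Der Δ (a ∧ b) → Der Δ a
  ∧-elimˡ d = by-contradiction (wk d) (deduction (ex-falso assumption (wk assumption)))

  ∧-elimʳ : Der Δ (a ∧ b) → Der Δ b
  ∧-elimʳ {a = a} {b} d = by-contradiction (wk d) (mp assumption (thm (ax1 (neg b) a)))

  -- φ ∨ ψ is by definition neg (neg φ) ∨ ψ = neg φ ⇒ ψ up to the involution.
  as-implication : Der Δ (a ∨ b) → Der Δ (neg a ⇒ b)
  as-implication {Δ} {a} {b} = subst (λ z → Der Δ (z ∨ b)) (sym (neg-involutive a))

  from-implication : Der Δ (neg a ⇒ b) → Der Δ (a ∨ b)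
  from-implication {Δ} {a} {b} = subst (λ z → Der Δ (z ∨ b)) (neg-involutive a)

  ∨-introˡ : Der Δ a → Der Δ (a ∨ b)
  ∨-introˡ d = from-implication (deduction (ex-falso (wk d) assumption))

  ∨-introʳ : Der Δ b → Der Δ (a ∨ b)
  ∨-introʳ {b = b} {a = a} d = from-implication (mp d (thm (ax1 b (neg a))))

  ∨-elim : Der Δ (a ∨ b) → Der Δ (neg a) → Der Δ b
  ∨-elim d e = mp e (as-implication d)

  ⊥-intro : Der Δ a → Der Δ (neg a) → Der Δ ⊥f
  ⊥-intro = ex-falso

  ⊥-to-neg : Der (Δ ,, a) ⊥f → Der Δ (neg a)
  ⊥-to-neg {Δ} {a} e = by-contradiction (subst (λ z → Der (Δ ,, z) _) (sym (neg-involutive a)) (∧-elimˡ e))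
                                         (subst (λ z → Der (Δ ,, z) _) (sym (neg-involutive a)) (∧-elimʳ e))

  ⊥-to-pos : Der (Δ ,, neg a) ⊥f → Der Δ a
  ⊥-to-pos e = by-contradiction (∧-elimˡ e) (∧-elimʳ e)

  contraposition : ⊢ (a ⇒ b) → ⊢ (neg b ⇒ neg a)
  contraposition t = der-∅⇒⊢ (deduction (⊥-to-neg (⊥-intro (mp assumption (thm t)) (wk assumption))))

  ⊢⊤ : ⊢ (⊤f {n})
  ⊢⊤ = ⊢-refl (nvar 0)

  compact : Der Δ a → Σ (List (Fm n)) λ L → All Δ L × Der (_∈ L) a
  compact (hyp {φ} x) = (φ ∷ []) , (x ∷ []) , hyp (here refl)
  compact (thm t) = [] , [] , thm t
  compact (mp d e) with compact d | compact e
  ... | L₁ , a₁ , d' | L₂ , a₂ , e' =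
    (L₁ ++ L₂) , ++⁺ a₁ a₂ , mp (weaken ∈-++⁺ˡ d') (weaken (∈-++⁺ʳ L₁) e')

  conjL-elim : (L : List (Fm n)) → Der Δ (conjL L) → ∀ {y} → y ∈ L → Der Δ y
  conjL-elim (φ ∷ []) d (here refl) = d
  conjL-elim (φ ∷ ψ ∷ L) d (here refl) = ∧-elimˡ d
  conjL-elim (φ ∷ ψ ∷ L) d (there m) = conjL-elim (ψ ∷ L) (∧-elimʳ d) m

  Cons : Theory → Set
  Cons Δ = ¬ Der Δ ⊥f

  consistent⇒Cons : (Γ : Theory) → Consistent Γ → Cons Γ
  consistent⇒Cons Γ c d with compact d
  ... | L , L⊆Γ , d' = c (L , L⊆Γ , der-∅⇒⊢ (deduction (cut (conjL-elim L assumption) d')))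

module Enumeration {n : ℕ} where

  unaryOps : List (Fm n → Fm n)
  unaryOps = □_ ∷ ◇_ ∷ concatMap (λ i → [ i ]_ ∷ ⟨ i ⟩_ ∷ []) (allFin n)

  binaryOps : List (Fm n → Fm n → Fm n)
  binaryOps = _∧_ ∷ _∨_ ∷ []

  grow : List (Fm n) → List (Fm n)
  grow L = concatMap (λ o → map o L) unaryOps ++ concatMap (λ o → cartesianProductWith o L L) binaryOps

  enum : ℕ → List (Fm n)
  enum zero = []
  enum (suc k) = enum k ++ var k ∷ nvar k ∷ grow (enum k)

  enum-mono : ∀ {k m} → k ≤ m → ∀ {φ} → φ ∈ enum k → φ ∈ enum m
  enum-mono k≤m = go (≤⇒≤′ k≤m)
    where
    go : ∀ {k m} → k ≤′ m → ∀ {φ} → φ ∈ enum k → φ ∈ enum m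
    go (≤′-reflexive refl) φ∈ = φ∈
    go (≤′-step k≤m) φ∈ = ∈-++⁺ˡ (go k≤m φ∈)

  unary-∈ : ∀ {a} (o : Fm n → Fm n) → o ∈ unaryOps → ∃ (λ k → a ∈ enum k) → ∃ λ k → o a ∈ enum k
  unary-∈ o o∈ (k , a∈) =
    suc k , ∈-++⁺ʳ (enum k) (there (there (∈-++⁺ˡ (∈-concatMap⁺ (λ o → map o (enum k)) (lose o∈ (∈-map⁺ o a∈))))))

  binary-∈ : ∀ {a b} (o : Fm n → Fm n → Fm n) → o ∈ binaryOps →
             ∃ (λ k → a ∈ enum k) → ∃ (λ k → b ∈ enum k) → ∃ λ k → o a b ∈ enum k
  binary-∈ o o∈ (ka , a∈) (kb , b∈) =
    suc k , ∈-++⁺ʳ (enum k) (there (there (∈-++⁺ʳ (concatMap (λ o → map o L) unaryOps)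
      (∈-concatMap⁺ (λ o → cartesianProductWith o L L) (lose o∈
        (∈-cartesianProductWith⁺ o (enum-mono (m≤m⊔n ka kb) a∈) (enum-mono (m≤n⊔m ka kb) b∈)))))))
    where
    k = ka ⊔ kb
    L = enum k

  agentOp-∈ : ∀ {o} (i : Fin n) → o ∈ ([ i ]_ ∷ ⟨ i ⟩_ ∷ []) → o ∈ unaryOps
  agentOp-∈ i o∈ = there (there (∈-concatMap⁺ (λ i → [ i ]_ ∷ ⟨ i ⟩_ ∷ []) (lose (∈-allFin i) o∈)))

  enum-complete : (φ : Fm n) → ∃ λ k → φ ∈ enum k
  enum-complete (var p) = suc p , ∈-++⁺ʳ (enum p) (here refl)
  enum-complete (nvar p) = suc p , ∈-++⁺ʳ (enum p) (there (here refl))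
  enum-complete (a ∧ b) = binary-∈ _∧_ (here refl) (enum-complete a) (enum-complete b)
  enum-complete (a ∨ b) = binary-∈ _∨_ (there (here refl)) (enum-complete a) (enum-complete b)
  enum-complete (□ a) = unary-∈ □_ (here refl) (enum-complete a)
  enum-complete (◇ a) = unary-∈ ◇_ (there (here refl)) (enum-complete a)
  enum-complete ([ i ] a) = unary-∈ [ i ]_ (agentOp-∈ i (here refl)) (enum-complete a)
  enum-complete (⟨ i ⟩ a) = unary-∈ ⟨ i ⟩_ (agentOp-∈ i (there (here refl))) (enum-complete a)

module MaximalConsistent {n : ℕ} (em : ExcludedMiddle 0ℓ) where
  open Derivation {n}
  open Enumeration {n}

  -- A maximal consistent set, represented by its characteristic function so
  -- that the set of all of them is small (the worlds of a frame live in Set).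
  record MCS : Set where
    field
      member : Fm n → Bool
      consistent : Cons (λ φ → member φ ≡ true)
      decides : ∀ φ → member φ ≡ true ⊎ member (neg φ) ≡ true

  infix 4 _∋_
  _∋_ : MCS → Fm n → Set
  x ∋ φ = MCS.member x φ ≡ true

  module _ (x : MCS) where

    closed : ∀ {φ} → Der (x ∋_) φ → x ∋ φ
    closed {φ} d with MCS.decides x φ
    ... | inj₁ h = h
    ... | inj₂ h = ⊥-elim (MCS.consistent x (⊥-intro d (hyp h)))

    not-both : ∀ {φ} → x ∋ φ → x ∋ neg φ → ⊥
    not-both h g = MCS.consistent x (⊥-intro (hyp h) (hyp g))

    modus-ponens : ∀ {φ ψ} → x ∋ φ → ⊢ (φ ⇒ ψ) → x ∋ ψ
    modus-ponens h t = closed (mp (hyp h) (thm t))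

    neg-∉ : ∀ {φ} → ¬ x ∋ φ → x ∋ neg φ
    neg-∉ {φ} h with MCS.decides x φ
    ... | inj₁ g = ⊥-elim (h g)
    ... | inj₂ g = g

    nvar-member : ∀ {p} → (¬ x ∋ var p) ⇔ x ∋ nvar p
    nvar-member = mk⇔ neg-∉ (λ h g → not-both g h)

    ∧-member : ∀ {φ ψ} → (x ∋ φ × x ∋ ψ) ⇔ x ∋ φ ∧ ψ
    ∧-member = mk⇔ (λ (a , b) → closed (∧-intro (hyp a) (hyp b)))
                   (λ h → closed (∧-elimˡ (hyp h)) , closed (∧-elimʳ (hyp h)))

    ∨-member : ∀ {φ ψ} → (x ∋ φ ⊎ x ∋ ψ) ⇔ x ∋ φ ∨ ψ
    ∨-member {φ} = mk⇔ [ (λ a → closed (∨-introˡ (hyp a))) , (λ b → closed (∨-introʳ (hyp b))) ]′ from-∨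
      where
      from-∨ : ∀ {ψ} → x ∋ φ ∨ ψ → x ∋ φ ⊎ x ∋ ψ
      from-∨ h with MCS.decides x φ
      ... | inj₁ a = inj₁ a
      ... | inj₂ ¬a = inj₂ (closed (∨-elim (hyp h) (hyp ¬a)))

  choose : (Δ : Theory) (φ : Fm n) → Dec (Cons (Δ ,, φ)) → Fm n
  choose Δ φ (yes _) = φ
  choose Δ φ (no _) = neg φ

  choose-cons : ∀ Δ φ (d : Dec (Cons (Δ ,, φ))) → Cons Δ → Cons (Δ ,, choose Δ φ d)
  choose-cons Δ φ (yes c) _ = c
  choose-cons Δ φ (no ¬c) c e = ¬c (λ e' → c (⊥-intro (⊥-to-pos e) (⊥-to-neg e')))

  choose-decides : ∀ Δ φ (d : Dec (Cons (Δ ,, φ))) → choose Δ φ d ≡ φ ⊎ choose Δ φ d ≡ neg φ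
  choose-decides Δ φ (yes _) = inj₁ refl
  choose-decides Δ φ (no _) = inj₂ refl

  saturate : List (Fm n) → Theory → Theory
  saturate [] Δ = Δ
  saturate (φ ∷ L) Δ = saturate L (Δ ,, choose Δ φ em)

  saturate-cons : ∀ L Δ → Cons Δ → Cons (saturate L Δ)
  saturate-cons [] Δ c = c
  saturate-cons (φ ∷ L) Δ c = saturate-cons L _ (choose-cons Δ φ em c)

  saturate-⊇ : ∀ L Δ {x} → Δ x → saturate L Δ x
  saturate-⊇ [] Δ x = x
  saturate-⊇ (φ ∷ L) Δ x = saturate-⊇ L _ (inj₁ x)

  saturate-decides : ∀ L Δ {φ} → φ ∈ L → saturate L Δ φ ⊎ saturate L Δ (neg φ)
  saturate-decides (φ ∷ L) Δ (here refl) with choose-decides Δ φ em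
  ... | inj₁ eq = inj₁ (saturate-⊇ L _ (inj₂ (sym eq)))
  ... | inj₂ eq = inj₂ (saturate-⊇ L _ (inj₂ (sym eq)))
  saturate-decides (ψ ∷ L) Δ (there m) = saturate-decides L _ m

  module Chain (Γ : Theory) (cΓ : Cons Γ) where

    chain : ℕ → Theory
    chain zero = Γ
    chain (suc k) = saturate (enum k) (chain k)

    chain-cons : ∀ k → Cons (chain k)
    chain-cons zero = cΓ
    chain-cons (suc k) = saturate-cons (enum k) (chain k) (chain-cons k)

    chain-mono : ∀ {k m} → k ≤ m → ∀ {x} → chain k x → chain m x
    chain-mono k≤m = go (≤⇒≤′ k≤m)
      where
      go : ∀ {k m} → k ≤′ m → ∀ {x} → chain k x → chain m x
      go (≤′-reflexive refl) x = x
      go (≤′-step {m} k≤m) x = saturate-⊇ (enum m) (chain m) (go k≤m x)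

    ⋃chain : Theory
    ⋃chain x = ∃ λ k → chain k x

    bound : ∀ (L : List (Fm n)) → All ⋃chain L → ∃ λ K → All (chain K) L
    bound [] [] = 0 , []
    bound (x ∷ L) ((k , c) ∷ a) with bound L a
    ... | K , aK = (k ⊔ K) , (chain-mono (m≤m⊔n k K) c ∷ All.map (chain-mono (m≤n⊔m k K)) aK)

    ⋃chain-cons : Cons ⋃chain
    ⋃chain-cons d with compact d
    ... | L , aL , d' with bound L aL
    ... | K , aK = chain-cons K (cut (λ m → hyp (lookup aK m)) d')

    ⋃chain-decides : ∀ φ → ⋃chain φ ⊎ ⋃chain (neg φ)
    ⋃chain-decides φ with enum-complete φ
    ... | k , m with saturate-decides (enum k) (chain k) m
    ... | inj₁ x = inj₁ (suc k , x)
    ... | inj₂ x = inj₂ (suc k , x)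

  characteristic : (Fm n → Set) → Fm n → Bool
  characteristic P φ with em {P φ}
  ... | yes _ = true
  ... | no _ = false

  characteristic-sound : ∀ P {φ} → characteristic P φ ≡ true → P φ
  characteristic-sound P {φ} eq with em {P φ}
  ... | yes p = p
  characteristic-sound P {φ} () | no _

  characteristic-complete : ∀ P {φ} → P φ → characteristic P φ ≡ true
  characteristic-complete P {φ} p with em {P φ}
  ... | yes _ = refl
  ... | no ¬p = ⊥-elim (¬p p)

  -- Lindenbaum lemma. Only its statement is used later, so the construction
  -- is opaque.
  opaque
    lindenbaum : (Δ : Theory) → Cons Δ → Σ MCS λ x → ∀ {φ} → Δ φ → x ∋ φ
    lindenbaum Δ c = x , (λ h → characteristic-complete ⋃chain (0 , h))
      where
      open Chain Δ c
      x : MCS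
      x = record
        { member = characteristic ⋃chain
        ; consistent = λ d → ⋃chain-cons (cut (hyp ∘ characteristic-sound ⋃chain) d)
        ; decides = λ φ → ⊎-map (characteristic-complete ⋃chain) (characteristic-complete ⋃chain)
                                (⋃chain-decides φ) }

  -- An S5 modality of Ldm: a box with its dual diamond satisfying K, T, 5 and
  -- necessitation. Both □ and every [i] are instances.
  record S5Modality : Set where
    field
      box dia : Fm n → Fm n
      neg-box : ∀ φ → neg (box φ) ≡ dia (neg φ)
      neg-dia : ∀ φ → neg (dia φ) ≡ box (neg φ)
      T : ∀ φ → ⊢ (box φ ⇒ φ)
      five : ∀ φ → ⊢ (dia φ ⇒ box (dia φ))
      K : ∀ φ ψ → ⊢ (box (φ ⇒ ψ) ⇒ (box φ ⇒ box ψ))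
      N : ∀ {φ} → ⊢ φ → ⊢ (box φ)

  module Canonical (M : S5Modality) where
    open S5Modality M

    box-der : ∀ {Δ Δ' : Theory} {φ} → (∀ {y} → Δ y → Δ' (box y)) → Der Δ φ → Der Δ' (box φ)
    box-der f (hyp x) = hyp (f x)
    box-der f (thm t) = thm (N t)
    box-der f (mp {φ} {ψ} d e) = mp (box-der f d) (mp (box-der f e) (thm (K φ ψ)))

    -- Axiom 4 is derivable in S5: from 5 for ¬χ by contraposition, ◇□χ → □χ, ...
    dia-box : ∀ χ → ⊢ (dia (box χ) ⇒ box χ)
    dia-box χ = subst₂ (λ a b → ⊢ (a ⇒ b)) neg-□◇¬ neg-◇¬ (contraposition (five (neg χ)))
      where
      neg-◇¬ : neg (dia (neg χ)) ≡ box χ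
      neg-◇¬ = trans (neg-dia _) (cong box (neg-involutive χ))
      neg-□◇¬ : neg (box (dia (neg χ))) ≡ dia (box χ)
      neg-□◇¬ = trans (neg-box _) (cong dia neg-◇¬)

    -- ... and □χ → ◇□χ (by T) → □◇□χ (by 5) → □□χ.
    four : ∀ (x : MCS) {χ} → x ∋ box χ → x ∋ box (box χ)
    four x {χ} h = modus-ponens x (modus-ponens x dia-box-χ (five _)) (mp (N (dia-box χ)) (K _ _))
      where
      dia-box-χ : x ∋ dia (box χ)
      dia-box-χ with MCS.decides x (dia (box χ))
      ... | inj₁ g = g
      ... | inj₂ g = ⊥-elim (not-both x h (modus-ponens x (subst (x ∋_) (neg-dia _) g) (T _)))

    Rc : MCS → MCS → Set
    Rc x u = ∀ φ → (x ∋ box φ → u ∋ box φ) × (u ∋ box φ → x ∋ box φ)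

    Rc-equiv : IsEquivalence Rc
    Rc-equiv = record
      { refl = λ φ → (λ h → h) , (λ h → h)
      ; sym = λ r φ → proj₂ (r φ) , proj₁ (r φ)
      ; trans = λ r s φ → (proj₁ (s φ) ∘ proj₁ (r φ)) , (proj₂ (r φ) ∘ proj₂ (s φ)) }

    box-elim : ∀ {x u : MCS} {φ} → x ∋ box φ → Rc x u → u ∋ φ
    box-elim {x} {u} {φ} h r = modus-ponens u (proj₁ (r φ) h) (T φ)

    dia-intro : ∀ {x u : MCS} {φ} → Rc x u → u ∋ φ → x ∋ dia φ
    dia-intro {x} {u} {φ} r h with MCS.decides x (dia φ)
    ... | inj₁ g = g
    ... | inj₂ g = ⊥-elim (not-both u h (box-elim {x} {u} (subst (x ∋_) (neg-dia φ) g) r))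

    -- Existence lemma: {y | box y ∈ x} ∪ {ψ} is consistent when dia ψ ∈ x.
    dia-elim : ∀ (x : MCS) {ψ} → x ∋ dia ψ → Σ MCS λ u → Rc x u × u ∋ ψ
    dia-elim x {ψ} h with lindenbaum (Boxed ,, ψ) cons
      where
      Boxed : Theory
      Boxed y = x ∋ box y
      cons : Cons (Boxed ,, ψ)
      cons d = not-both x h (subst (x ∋_) (sym (neg-dia ψ)) (closed x (box-der (λ g → g) (⊥-to-neg d))))
    ... | u , incl = u , related , incl (inj₂ refl)
      where
      related : Rc x u
      related φ = (λ g → incl (inj₁ (four x g))) , back
        where
        back : u ∋ box φ → x ∋ box φ
        back g with MCS.decides x (box φ)
        ... | inj₁ k = k
        ... | inj₂ k = ⊥-elim (not-both u g (subst (u ∋_) (sym (neg-box φ))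
                         (incl (inj₁ (modus-ponens x (subst (x ∋_) (neg-box φ) k) (five _))))))

    box-intro : ∀ (x : MCS) {φ} → (∀ u → Rc x u → u ∋ φ) → x ∋ box φ
    box-intro x {φ} f with MCS.decides x (box φ)
    ... | inj₁ h = h
    ... | inj₂ h with dia-elim x (subst (x ∋_) (neg-box φ) h)
    ... | u , r , g = ⊥-elim (not-both u (f u r) g)

  □-modality : S5Modality
  □-modality = record
    { box = □_ ; dia = ◇_ ; neg-box = λ _ → refl ; neg-dia = λ _ → refl
    ; T = T□ ; five = 5□ ; K = K□ ; N = nec }

  -- Necessitation for [i] is derived from □φ → [i]φ.
  agent-modality : Fin n → S5Modality
  agent-modality i = record
    { box = [ i ]_ ; dia = ⟨ i ⟩_ ; neg-box = λ _ → refl ; neg-dia = λ _ → refl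
    ; T = Ti i ; five = 5i i ; K = Ki i ; N = λ t → mp (nec t) (□i i _) }

  module □c = Canonical □-modality
  module Ac (i : Fin n) = Canonical (agent-modality i)

  R□c : MCS → MCS → Set
  R□c = □c.Rc

  Rc : Fin n → MCS → MCS → Set
  Rc i = Ac.Rc i

  -- C1 for the canonical relations: □φ ∈ x gives [i]□φ ∈ x by 4 and □ψ → [i]ψ,
  -- which transfers along Rc i, and T for [i] returns □φ.
  canonical-C1 : ∀ i {x u} → Rc i x u → R□c x u
  canonical-C1 i {x} {u} r φ = transfer x u (proj₁ (r (□ φ))) , transfer u x (proj₂ (r (□ φ)))
    where
    transfer : ∀ a b → (a ∋ ([ i ] □ φ) → b ∋ ([ i ] □ φ)) → a ∋ (□ φ) → b ∋ (□ φ)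
    transfer a b g h = modus-ponens b (g (modus-ponens a (□c.four a h) (□i i (□ φ)))) (Ti i (□ φ))

  conj-intro : ∀ (x : MCS) k (g : Fin k → Fm n) → (∀ i → x ∋ g i) → x ∋ conj k g
  conj-intro x zero g h = closed x (thm ⊢⊤)
  conj-intro x (suc zero) g h = h zero
  conj-intro x (suc (suc k)) g h =
    closed x (∧-intro (hyp (h zero)) (hyp (conj-intro x (suc k) (g ∘ suc) (h ∘ suc))))

  conj-elim : ∀ (x : MCS) k (g : Fin k → Fm n) → x ∋ conj k g → ∀ i → x ∋ g i
  conj-elim x (suc zero) g h zero = h
  conj-elim x (suc (suc k)) g h zero = closed x (∧-elimˡ (hyp h))
  conj-elim x (suc (suc k)) g h (suc i) = conj-elim x (suc k) (g ∘ suc) (closed x (∧-elimʳ (hyp h))) i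

  -- It extends the set of
  -- all guarantees [i]β ∈ u i, which is consistent by the axiom (IA).
  module Independence (u : Fin n → MCS) (i₀ : Fin n) (related : ∀ i j → R□c (u i) (u j)) where

    Guarantees : Theory
    Guarantees y = ∃₂ λ i β → y ≡ [ i ] β × u i ∋ [ i ] β

    Admissible : (Fin n → Fm n) → Set
    Admissible f = ∀ i → u i ∋ [ i ] f i

    Choice : (Fin n → Fm n) → Theory
    Choice f y = ∃ λ i → y ≡ [ i ] f i

    joint : ∀ f → Admissible f → Σ MCS λ z → ∀ i → z ∋ [ i ] f i
    joint f adm with □c.dia-elim (u i₀) ◇⋀ where
      ◇⋀ : u i₀ ∋ ◇ conj n (λ i → [ i ] f i)
      ◇⋀ = modus-ponens (u i₀)
             (conj-intro (u i₀) n (λ i → ◇ [ i ] f i) (λ i → □c.dia-intro {u i₀} {u i} (related i₀ i) (adm i)))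
             (IA f)
    ... | z , _ , ⋀∈z = z , conj-elim z n _ ⋀∈z

    -- Adding a guarantee [j]β to slot j of a choice vector f gives f' with
    -- [j]f' j = [j](f j ∧ β), which is admissible and derives both [i] f i and [j]β.
    module Update (f : Fin n → Fm n) (j : Fin n) (β : Fm n) where
      f' : Fin n → Fm n
      f' = updateAt f j (_∧ β)

      slot-j : [ j ] (f j ∧ β) ≡ [ j ] f' j
      slot-j = cong [ j ]_ (sym (updateAt-updates j f))

      slot-other : ∀ i → i ≢ j → [ i ] f i ≡ [ i ] f' i
      slot-other i i≢j = cong [ i ]_ (sym (updateAt-minimal i j f i≢j))

      from-slot-j : ∀ {a} → Der (λ z → z ≡ (f j ∧ β)) a → Der (Choice f') ([ j ] a)
      from-slot-j = Ac.box-der j (λ { refl → j , slot-j })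

      admissible : Admissible f → u j ∋ [ j ] β → Admissible f'
      admissible adm h i with i ≟ᶠ j
      ... | yes refl = subst (u j ∋_) slot-j
              (closed (u j) (Ac.box-der j {Δ = λ z → z ≡ f j ⊎ z ≡ β}
                                (λ { (inj₁ refl) → adm j ; (inj₂ refl) → h })
                                (∧-intro (hyp (inj₁ refl)) (hyp (inj₂ refl)))))
      ... | no i≢j = subst (u i ∋_) (slot-other i i≢j) (adm i)

      keeps : ∀ {y} → Choice f y → Der (Choice f') y
      keeps (i , refl) with i ≟ᶠ j
      ... | yes refl = from-slot-j (∧-elimˡ (hyp refl))
      ... | no i≢j = hyp (i , slot-other i i≢j)

      adds : Der (Choice f') ([ j ] β)
      adds = from-slot-j (∧-elimʳ (hyp refl))

    collect : (L : List (Fm n)) → All Guarantees L →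
              Σ (Fin n → Fm n) λ f → Admissible f × All (Der (Choice f)) L
    collect [] [] = (λ _ → ⊤f) , (λ i → closed (u i) (thm (S5Modality.N (agent-modality i) ⊢⊤))) , []
    collect (_ ∷ L) ((j , β , refl , h) ∷ gs) with collect L gs
    ... | f , adm , ders = f' , admissible adm h , adds ∷ All.map (cut keeps) ders
      where open Update f j β

    guarantees-cons : Cons Guarantees
    guarantees-cons d with compact d
    ... | L , gs , d' with collect L gs
    ... | f , adm , ders with joint f adm
    ... | z , hz = MCS.consistent z (cut (λ y∈L → hyp (closed z (cut in-z (lookup ders y∈L)))) d')
      where
      in-z : ∀ {y} → Choice f y → Der (z ∋_) y
      in-z (i , refl) = hyp (hz i)

    -- A maximal extension of the guarantees is a common Rc i-successor: if it
    -- contained [i]φ ∉ u i, then [i]⟨i⟩¬φ ∈ u i by 5 would put ⟨i⟩¬φ in it.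
    successor : Σ MCS λ v → ∀ i → Rc i (u i) v
    successor with lindenbaum Guarantees guarantees-cons
    ... | v , incl = v , λ i φ → (λ g → incl (i , φ , refl , g)) , back i φ
      where
      back : ∀ i φ → v ∋ [ i ] φ → u i ∋ [ i ] φ
      back i φ g with MCS.decides (u i) ([ i ] φ)
      ... | inj₁ k = k
      ... | inj₂ k = ⊥-elim (not-both v g (modus-ponens v
                       (incl (i , ⟨ i ⟩ neg φ , refl , modus-ponens (u i) k (5i i (neg φ))))
                       (Ti i (⟨ i ⟩ neg φ))))

record LdmFrame (n : ℕ) : Set₁ where
  field
    S   : Set
    s₀  : S
    R□  : Rel S
    R   : Fin n → Rel S
    eq□ : IsEquivalence R□
    eqi : ∀ i → IsEquivalence (R i)
    C1  : ∀ i {w v} → R i w v → R□ w v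
    C2  : ∀ (u : Fin n → S) → (∀ i j → R□ (u i) (u j)) → ∃ λ v → ∀ i → R i (u i) v

-- The Tstit-frame on S × ℕ: moment 0 carries the given frame, every later
-- moment is a discrete copy of S, and time runs from (x , k) to (x , m) for
-- k < m. Histories never branch after moment 0, which makes C6 immediate.
-- The nonempty agent set is needed to read off the moment of a profile in C2.
module Timeline {n : ℕ} (F : LdmFrame n) (i₀ : Fin n) where
  open LdmFrame F

  W : Set
  W = S × ℕ

  onMoment : Rel S → ℕ → Rel S
  onMoment Q zero = Q
  onMoment Q (suc _) = _≡_

  lift : Rel S → Rel W
  lift Q (x , k) (y , m) = k ≡ m × onMoment Q k x y

  lift-equiv : ∀ {Q} → IsEquivalence Q → IsEquivalence (lift Q)
  lift-equiv {Q} e = record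
    { refl = λ {a} → lift-refl a
    ; sym = λ {a} {b} → lift-sym a b
    ; trans = λ {a} {b} {c} → lift-trans a b c }
    where
    module E = IsEquivalence e
    lift-refl : ∀ a → lift Q a a
    lift-refl (x , zero) = refl , E.refl
    lift-refl (x , suc k) = refl , refl
    lift-sym : ∀ a b → lift Q a b → lift Q b a
    lift-sym (x , zero) (y , .zero) (refl , r) = refl , E.sym r
    lift-sym (x , suc k) (y , .(suc k)) (refl , r) = refl , sym r
    lift-trans : ∀ a b c → lift Q a b → lift Q b c → lift Q a c
    lift-trans (x , zero) (y , .zero) (z , .zero) (refl , r) (refl , s) = refl , E.trans r s
    lift-trans (x , suc k) (y , .(suc k)) (z , .(suc k)) (refl , r) (refl , s) = refl , trans r s

  RAg : Rel W
  RAg a b = ∀ i → lift (R i) a b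

  RAg-equiv : IsEquivalence RAg
  RAg-equiv = record
    { refl = λ i → IsEquivalence.refl (lift-equiv (eqi i))
    ; sym = λ r i → IsEquivalence.sym (lift-equiv (eqi i)) (r i)
    ; trans = λ r s i → IsEquivalence.trans (lift-equiv (eqi i)) (r i) (s i) }

  RG : Rel W
  RG (x , k) (y , m) = x ≡ y × k < m

  lift-C1 : ∀ i a b → lift (R i) a b → lift R□ a b
  lift-C1 i (x , zero) (y , m) (e , r) = e , C1 i r
  lift-C1 i (x , suc k) (y , m) (e , r) = e , r

  -- Pairwise □-related profiles lie on one moment: at moment 0 use C2 of F,
  -- at a later moment the profile is constant.
  lift-C2 : ∀ (u : Fin n → W) → (∀ i j → lift R□ (u i) (u j)) → ∃ λ v → ∀ i → lift (R i) (u i) v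
  lift-C2 u related with proj₂ (u i₀) in eq
  ... | zero = (proj₁ v , 0) , λ i → at-0 i , pick-0 (proj₂ (u i)) (at-0 i) (proj₂ v i)
    where
    at-0 : ∀ i → proj₂ (u i) ≡ 0
    at-0 i = trans (proj₁ (related i i₀)) eq
    drop-0 : ∀ {Q x y} k → k ≡ 0 → onMoment Q k x y → Q x y
    drop-0 zero _ r = r
    pick-0 : ∀ {Q x y} k → k ≡ 0 → Q x y → onMoment Q k x y
    pick-0 zero _ r = r
    v : ∃ λ v → ∀ i → R i (proj₁ (u i)) v
    v = C2 (proj₁ ∘ u) (λ i j → drop-0 (proj₂ (u i)) (at-0 i) (proj₂ (related i j)))
  ... | suc k = u i₀ , λ i → proj₁ (related i i₀) , later (proj₂ (u i)) (at-k i) (proj₂ (related i i₀))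
    where
    at-k : ∀ i → proj₂ (u i) ≡ suc k
    at-k i = trans (proj₁ (related i i₀)) eq
    later : ∀ {Q Q' x y} m → m ≡ suc k → onMoment Q m x y → onMoment Q' m x y
    later (suc _) _ r = r

  G-trans : ∀ a b c → RG a b → RG b c → RG a c
  G-trans (x , k) (y , m) (z , p) (e₁ , l₁) (e₂ , l₂) = trans e₁ e₂ , <-trans l₁ l₂

  G-linear : ∀ a u v → RG a u → RG a v → RG u v ⊎ u ≡ v ⊎ RG v u
  G-linear (x , k) (y , m) (z , p) (e₁ , _) (e₂ , _) with <-cmp m p
  ... | tri< m<p _ _ = inj₁ (trans (sym e₁) e₂ , m<p)
  ... | tri≈ _ m≡p _ = inj₂ (inj₁ (cong₂ _,_ (trans (sym e₁) e₂) m≡p))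
  ... | tri> _ _ p<m = inj₂ (inj₂ (trans (sym e₂) e₁ , p<m))

  H-linear : ∀ a u v → RG u a → RG v a → RG v u ⊎ u ≡ v ⊎ RG u v
  H-linear (x , k) (y , m) (z , p) (e₁ , _) (e₂ , _) with <-cmp m p
  ... | tri< m<p _ _ = inj₂ (inj₂ (trans e₁ (sym e₂) , m<p))
  ... | tri≈ _ m≡p _ = inj₂ (inj₁ (cong₂ _,_ (trans e₁ (sym e₂)) m≡p))
  ... | tri> _ _ p<m = inj₁ (trans e₂ (sym e₁) , p<m)

  -- C6: a moment reached by RG is discrete, so its □-alternatives are itself.
  C6 : ∀ a u v → RG a u → lift R□ u v → ∃ λ z → RAg a z × RG z v
  C6 (x , k) (y , suc m) (z , .(suc m)) (x≡y , k<m) (refl , y≡z) =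
    (x , k) , IsEquivalence.refl RAg-equiv , trans x≡y y≡z , k<m

  C7 : ∀ a u → lift R□ a u → ¬ RG a u
  C7 (x , k) (y , m) (k≡m , _) (_ , k<m) = <-irrefl k≡m k<m

  frame : TstitFrame n
  frame = record
    { W = W ; w₀ = (s₀ , 0) ; R□ = lift R□ ; R = λ i → lift (R i) ; RAg = RAg
    ; RG = RG ; RH = λ a b → RG b a
    ; eq□ = lift-equiv eq□ ; eqi = λ i → lift-equiv (eqi i) ; eqAg = RAg-equiv
    ; C1 = lift-C1 ; C2 = lift-C2 ; C3 = λ _ _ → (λ r → r) , (λ r → r)
    ; G-trans = G-trans ; G-serial = λ { (x , k) → (x , suc k) , refl , n<1+n k }
    ; H-conv = λ _ _ → (λ r → r) , (λ r → r)
    ; C4 = G-linear ; C5 = H-linear ; C6 = C6 ; C7 = C7 }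

module CanonicalModel {n : ℕ} (em : ExcludedMiddle 0ℓ) (i₀ : Fin n) where
  open MaximalConsistent {n} em

  canonical-frame : MCS → LdmFrame n
  canonical-frame x₀ = record
    { S = MCS ; s₀ = x₀ ; R□ = R□c ; R = Rc
    ; eq□ = □c.Rc-equiv ; eqi = Ac.Rc-equiv ; C1 = canonical-C1
    ; C2 = λ u related → Independence.successor u i₀ related }

  module _ (x₀ : MCS) where
    open Timeline (canonical-frame x₀) i₀ using (frame; lift)

    model : TstitModel n
    model = record { frame = frame ; V = λ p w → proj₁ w ∋ var p }

    _⊨₀_ : MCS → Fm n → Set
    x ⊨₀ φ = _⊨_ model (x , 0) φ

    module ModalTruth (M : S5Modality) {φ} (ih : ∀ y → y ⊨₀ φ ⇔ y ∋ φ) (x : MCS) where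
      open S5Modality M using (box; dia)
      module C = Canonical M

      box-truth : (∀ u → lift C.Rc (x , 0) u → _⊨_ model u φ) ⇔ x ∋ box φ
      box-truth = mk⇔ (λ h → C.box-intro x (λ y r → to (ih y) (h (y , 0) (refl , r))))
                      (λ { h (y , .0) (refl , r) → from (ih y) (C.box-elim {x} {y} h r) })

      dia-truth : (∃ λ u → lift C.Rc (x , 0) u × _⊨_ model u φ) ⇔ x ∋ dia φ
      dia-truth = mk⇔ (λ { ((y , .0) , (refl , r) , s) → C.dia-intro {x} {y} r (to (ih y) s) })
                      (λ h → let (y , r , g) = C.dia-elim x h in (y , 0) , (refl , r) , from (ih y) g)

    truth : ∀ φ x → x ⊨₀ φ ⇔ x ∋ φ
    truth (var p) x = ⇔-id (x ∋ var p)
    truth (nvar p) x = nvar-member x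
    truth (φ ∧ ψ) x = ∧-member x ⇔-∘ (truth φ x ×-⇔ truth ψ x)
    truth (φ ∨ ψ) x = ∨-member x ⇔-∘ (truth φ x ⊎-⇔ truth ψ x)
    truth (□ φ) x = ModalTruth.box-truth □-modality (λ y → truth φ y) x
    truth (◇ φ) x = ModalTruth.dia-truth □-modality (λ y → truth φ y) x
    truth ([ i ] φ) x = ModalTruth.box-truth (agent-modality i) (λ y → truth φ y) x
    truth (⟨ i ⟩ φ) x = ModalTruth.dia-truth (agent-modality i) (λ y → truth φ y) x

theorem2 : ExcludedMiddle 0ℓ → (n : ℕ) → 1 ≤ n → (Γ : Fm n → Set) → Consistent Γ →
    Σ (TstitModel n) λ M → Σ (TstitModel.W M) λ w → ∀ φ → Γ φ → _⊨_ M w φ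
theorem2 em (suc _) _ Γ Γ-consistent
  with MaximalConsistent.lindenbaum em Γ (Derivation.consistent⇒Cons Γ Γ-consistent)
... | x , Γ⊆x = model x , (x , 0) , λ φ φ∈Γ → from (truth x φ x) (Γ⊆x φ∈Γ)
  where open CanonicalModel em zero using (model; truth)
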